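{- Let $G=(V,E)$ be a finite graph with maximum degree at most $\Delta$. Then $C(I_2(G))\leq \left\lceil\frac{\Delta+1}{2}\right\rceil$.
   Context: Graphs are finite, simple and undirected. For a graph $G=(V,E)$ and an integer $n\geq 1$, $I_n(G)$ is the simplicial complex $\{U\subseteq V:\ \alpha(G[U])<n\}$, where $\alpha$ is the independence number; so $I_2(G)$ is the clique complex of $G$. For a finite simplicial complex $X$, a face $\sigma$ contained in a unique maximal face $\tau$ is a free face; if $|\sigma|\leq d$, removing all faces $\eta$ with $\sigma\subseteq\eta\subseteq\tau$ is an elementary $d$-collapse. $X$ is $d$-collapsible if a sequence of elementary $d$-collapses reduces it to the void complex (no faces at all). $C(X)$ is the minimum $d$ such that $X$ is $d$-collapsible. -}

module Defs where

open import Data.Nat using (ℕ; _≤_; _<_)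
open import Data.Bool using (Bool; true; false)
open import Data.Fin using (Fin)
open import Data.Fin.Subset using (Subset; _∈_; _⊆_; ∣_∣)
open import Data.Vec using (tabulate)
open import Data.Product using (_×_)
open import Relation.Nullary using (¬_)
open import Relation.Binary.PropositionalEquality using (_≡_)

record Graph (n : ℕ) : Set where
  field
    adj    : Fin n → Fin n → Bool
    sym    : ∀ u v → adj u v ≡ adj v u
    irrefl : ∀ v → adj v v ≡ false
open Graph public

neighbours : ∀ {n} → Graph n → Fin n → Subset n
neighbours G v = tabulate (λ u → adj G v u)

degree : ∀ {n} → Graph n → Fin n → ℕ
degree G v = ∣ neighbours G v ∣

MaxDegreeAtMost : ∀ {n} → Graph n → ℕ → Set
MaxDegreeAtMost G Δ = ∀ v → degree G v ≤ Δ

Independent : ∀ {n} → Graph n → Subset n → Set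
Independent G W = ∀ u v → u ∈ W → v ∈ W → adj G u v ≡ false

-- α(G[U]) < k : every independent set of G contained in U has fewer than k vertices.
IndepNumberBelow : ∀ {n} → Graph n → Subset n → ℕ → Set
IndepNumberBelow G U k = ∀ W → W ⊆ U → Independent G W → ∣ W ∣ < k

Complex : ℕ → Set₁
Complex n = Subset n → Set

-- I_k(G) = { U ⊆ V : α(G[U]) < k }.  I 2 G is the clique complex.
I : ∀ {n} → ℕ → Graph n → Complex n
I k G U = IndepNumberBelow G U k

FreeIn : ∀ {n} → Complex n → Subset n → Subset n → Set
FreeIn X σ τ = X σ × X τ × σ ⊆ τ × (∀ η → X η → σ ⊆ η → η ⊆ τ)

remove : ∀ {n} → Complex n → Subset n → Subset n → Complex n
remove X σ τ η = X η × ¬ (σ ⊆ η × η ⊆ τ)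

-- X is d-collapsible: a sequence of elementary d-collapses reduces X
-- to the void complex (no faces at all).
data Collapsible {n : ℕ} (d : ℕ) (X : Complex n) : Set₁ where
  void : (∀ η → ¬ X η) → Collapsible d X
  step : (σ τ : Subset n) → FreeIn X σ τ → ∣ σ ∣ ≤ d →
         Collapsible d (remove X σ τ) → Collapsible d X

-- C(X) ≤ d, where C(X) is the minimum d such that X is d-collapsible.
-- (d-collapsibility is monotone in d, so C(X) ≤ d iff X is d-collapsible.)
CollapsibilityAtMost : ∀ {n} → Complex n → ℕ → Set₁
CollapsibilityAtMost X d = Collapsible d X

-- Write d = ⌈(Δ + 1)/2⌉ and say that a vertex set S satisfies the degree bound for d if
-- every v ∈ S is adjacent to all of S - v or has fewer than 2d neighbours in S.  The clique
-- complex of G[S] is then d-collapsible, by induction on |S|: pick v ∈ S.  If v is adjacent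
-- to all of S - v, the complex is the cone with apex v over the clique complex of G[S - v],
-- and collapses of the base lift to the cone.  Otherwise the complex is the clique complex of
-- G[S - v] with the cone v ∗ lk(v) attached, lk(v) being the clique complex of G[N(v) ∩ S].
-- As |N(v) ∩ S| ≤ 2d - 1, a vertex of N(v) ∩ S not adjacent to all of it has at most
-- 2d - 3 neighbours there, so N(v) ∩ S satisfies the degree bound for d - 1 and lk(v) is
-- (d - 1)-collapsible.  Adding v to both faces of each collapse of lk(v) gives d-collapses
-- that remove the cone, and the clique complex of G[S - v] is left.  Maximum degree Δ gives
-- the degree bound for all of V, and I₂(G) is the clique complex of G.

module Submission where

open import Defs hiding (sym)
open import Data.Nat using (ℕ; zero; suc; ⌈_/2⌉; _≤_; _<_; _+_; z≤n; s≤s)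
open import Data.Nat.Properties
  using (module ≤-Reasoning; ≤⇒≯; ≤-refl; ≤-reflexive; ≤-trans; ≤-pred; n≤1+n; +-suc;
         +-monoʳ-≤; +-monoˡ-≤; ⌊n/2⌋≤⌈n/2⌉; ⌊n/2⌋+⌈n/2⌉≡n)
open import Data.Bool using (true; false)
import Data.Bool.Properties as Bool
open import Data.Fin using (Fin) renaming (_≟_ to _≟ᶠ_)
open import Data.Fin.Properties using (any?)
open import Data.Fin.Subset
  using (Subset; Empty; _∈_; _∉_; _⊆_; ∣_∣; inside; outside; ⊤; ⊥; ⁅_⁆; _∪_; _∩_; _─_; _-_)
open import Data.Fin.Subset.Properties
  using (_∈?_; nonempty?; ∉⊥; ∈⊤; ⊥⊆; ⊆-antisym; Empty-unique; p⊆q⇒∣p∣≤∣q∣; p⊂q⇒∣p∣<∣q∣;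
         ∣⊥∣≡0; ∣p∣≤n; ∣p∩q∣≤∣p∣; x∈⁅x⁆; x∈⁅y⁆⇒x≡y; x∉⁅y⁆⇒x≢y; x≢y⇒x∉⁅y⁆; ∣⁅x⁆∣≡1;
         x∈p∩q⁺; x∈p∩q⁻; p∩q⊆q; x∈p∪q⁺; x∈p∪q⁻; p─q⊆p; x∈p∧x≢y⇒x∈p-y; x∈p⇒∣p-x∣<∣p∣)
open import Data.Vec using (_∷_; []; here; there)
open import Data.Vec.Properties using (lookup∘tabulate; []=⇒lookup; lookup⇒[]=)
open import Data.Product using (_×_; _,_; proj₁; proj₂)
open import Data.Product.Function.NonDependent.Propositional using (_×-⇔_)
open import Data.Sum using (_⊎_; inj₁; inj₂)
open import Data.Empty using (⊥-elim)
open import Function using (id; _∘_; _⇔_; mk⇔; Equivalence)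
open import Relation.Nullary using (¬_; yes; no; ¬?; contradiction)
open import Relation.Nullary.Decidable using (_×-dec_)
open import Relation.Unary using (_≐_)
open import Relation.Binary.PropositionalEquality
  using (_≡_; _≢_; refl; sym; trans; subst; cong; ≢-sym)

private variable
  n : ℕ
  x y : Fin n
  p q : Subset n

x∈p─q⇒x∉q : ∀ (p q : Subset n) → x ∈ p ─ q → x ∉ q
x∈p─q⇒x∉q (inside ∷ p) (outside ∷ q) here ()
x∈p─q⇒x∉q (_ ∷ p) (_ ∷ q) (there x∈p─q) (there x∈q) = x∈p─q⇒x∉q p q x∈p─q x∈q

x∈p-y⇒x∈p : x ∈ p - y → x ∈ p
x∈p-y⇒x∈p = p─q⊆p _ _

x∈p-y⇒x≢y : x ∈ p - y → x ≢ y
x∈p-y⇒x≢y {p = p} {y = y} = x∉⁅y⁆⇒x≢y ∘ x∈p─q⇒x∉q p ⁅ y ⁆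

x∉p-x : x ∉ p - x
x∉p-x x∈p-x = x∈p-y⇒x≢y x∈p-x refl

x∈⁅y⁆∪p⁻ : x ∈ ⁅ y ⁆ ∪ p → x ≡ y ⊎ x ∈ p
x∈⁅y⁆∪p⁻ {y = y} {p = p} x∈ with x∈p∪q⁻ ⁅ y ⁆ p x∈
... | inj₁ x∈⁅y⁆ = inj₁ (x∈⁅y⁆⇒x≡y y x∈⁅y⁆)
... | inj₂ x∈p   = inj₂ x∈p

y∈⁅y⁆∪p : y ∈ ⁅ y ⁆ ∪ p
y∈⁅y⁆∪p {y = y} = x∈p∪q⁺ (inj₁ (x∈⁅x⁆ y))

x∈p⇒x∈⁅y⁆∪p : x ∈ p → x ∈ ⁅ y ⁆ ∪ p
x∈p⇒x∈⁅y⁆∪p = x∈p∪q⁺ ∘ inj₂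

x∉p∧p⊆q⇒p⊆q-x : x ∉ p → p ⊆ q → p ⊆ q - x
x∉p∧p⊆q⇒p⊆q-x x∉p p⊆q y∈p = x∈p∧x≢y⇒x∈p-y (p⊆q y∈p) λ { refl → x∉p y∈p }

p⊆q⇒p-x⊆q-x : p ⊆ q → p - x ⊆ q - x
p⊆q⇒p-x⊆q-x p⊆q y∈p-x = x∈p∧x≢y⇒x∈p-y (p⊆q (x∈p-y⇒x∈p y∈p-x)) (x∈p-y⇒x≢y y∈p-x)

x∈q∧p-x⊆q⇒p⊆q : x ∈ q → p - x ⊆ q → p ⊆ q
x∈q∧p-x⊆q⇒p⊆q {x = x} x∈q p-x⊆q {y} y∈p with y ≟ᶠ x
... | yes refl = x∈q
... | no y≢x   = p-x⊆q (x∈p∧x≢y⇒x∈p-y y∈p y≢x)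

p⊆⁅x⁆∪q⇒p-x⊆q : p ⊆ ⁅ x ⁆ ∪ q → p - x ⊆ q
p⊆⁅x⁆∪q⇒p-x⊆q p⊆ y∈p-x with x∈⁅y⁆∪p⁻ (p⊆ (x∈p-y⇒x∈p y∈p-x))
... | inj₁ y≡x = contradiction y≡x (x∈p-y⇒x≢y y∈p-x)
... | inj₂ y∈q = y∈q

p-x⊆q⇒p⊆⁅x⁆∪q : p - x ⊆ q → p ⊆ ⁅ x ⁆ ∪ q
p-x⊆q⇒p⊆⁅x⁆∪q {x = x} p-x⊆q {y} y∈p with y ≟ᶠ x
... | yes refl = y∈⁅y⁆∪p
... | no y≢x   = x∈p⇒x∈⁅y⁆∪p (p-x⊆q (x∈p∧x≢y⇒x∈p-y y∈p y≢x))

p-x⊆q⇔p⊆⁅x⁆∪q : (p - x ⊆ q) ⇔ (p ⊆ ⁅ x ⁆ ∪ q)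
p-x⊆q⇔p⊆⁅x⁆∪q = mk⇔ p-x⊆q⇒p⊆⁅x⁆∪q p⊆⁅x⁆∪q⇒p-x⊆q

p⊆q-x⇔p⊆q : x ∉ p → (p ⊆ q - x) ⇔ (p ⊆ q)
p⊆q-x⇔p⊆q {x = x} {p = p} {q = q} x∉p = mk⇔ to (x∉p∧p⊆q⇒p⊆q-x x∉p)
  where
  to : p ⊆ q - x → p ⊆ q
  to p⊆q-x y∈p = x∈p-y⇒x∈p (p⊆q-x y∈p)

p⊆q-x⇔⁅x⁆∪p⊆q : x ∈ q → x ∉ p → (p ⊆ q - x) ⇔ (⁅ x ⁆ ∪ p ⊆ q)
p⊆q-x⇔⁅x⁆∪p⊆q {x = x} {q = q} {p = p} x∈q x∉p = mk⇔ to from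
  where
  from : ⁅ x ⁆ ∪ p ⊆ q → p ⊆ q - x
  from ⁅x⁆∪p⊆q = x∉p∧p⊆q⇒p⊆q-x x∉p (λ y∈p → ⁅x⁆∪p⊆q (x∈p⇒x∈⁅y⁆∪p y∈p))
  to : p ⊆ q - x → ⁅ x ⁆ ∪ p ⊆ q
  to p⊆q-x y∈ with x∈⁅y⁆∪p⁻ y∈
  ... | inj₁ refl = x∈q
  ... | inj₂ y∈p  = x∈p-y⇒x∈p (p⊆q-x y∈p)

p-x≡p : x ∉ p → p - x ≡ p
p-x≡p {p = p} x∉p = ⊆-antisym x∈p-y⇒x∈p (x∉p∧p⊆q⇒p⊆q-x {q = p} x∉p id)

⁅x⁆∪p-x≡p : x ∉ p → ⁅ x ⁆ ∪ p - x ≡ p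
⁅x⁆∪p-x≡p {x = x} {p = p} x∉p =
  ⊆-antisym (p⊆⁅x⁆∪q⇒p-x⊆q {p = ⁅ x ⁆ ∪ p} id) (x∉p∧p⊆q⇒p⊆q-x x∉p x∈p⇒x∈⁅y⁆∪p)

∣p∪q∣≤∣p∣+∣q∣ : ∀ (p q : Subset n) → ∣ p ∪ q ∣ ≤ ∣ p ∣ + ∣ q ∣
∣p∪q∣≤∣p∣+∣q∣ []            []            = z≤n
∣p∪q∣≤∣p∣+∣q∣ (inside  ∷ p) (inside  ∷ q) =
  s≤s (≤-trans (∣p∪q∣≤∣p∣+∣q∣ p q) (+-monoʳ-≤ ∣ p ∣ (n≤1+n ∣ q ∣)))
∣p∪q∣≤∣p∣+∣q∣ (inside  ∷ p) (outside ∷ q) = s≤s (∣p∪q∣≤∣p∣+∣q∣ p q)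
∣p∪q∣≤∣p∣+∣q∣ (outside ∷ p) (inside  ∷ q) =
  ≤-trans (s≤s (∣p∪q∣≤∣p∣+∣q∣ p q)) (≤-reflexive (sym (+-suc ∣ p ∣ ∣ q ∣)))
∣p∪q∣≤∣p∣+∣q∣ (outside ∷ p) (outside ∷ q) = ∣p∪q∣≤∣p∣+∣q∣ p q

∣⁅x⁆∪p∣≤1+∣p∣ : ∀ x (p : Subset n) → ∣ ⁅ x ⁆ ∪ p ∣ ≤ suc ∣ p ∣
∣⁅x⁆∪p∣≤1+∣p∣ x p =
  subst (λ k → ∣ ⁅ x ⁆ ∪ p ∣ ≤ k + ∣ p ∣) (∣⁅x⁆∣≡1 x) (∣p∪q∣≤∣p∣+∣q∣ ⁅ x ⁆ p)

∣p∣≤1+∣p-x∣ : ∀ (p : Subset n) x → ∣ p ∣ ≤ suc ∣ p - x ∣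
∣p∣≤1+∣p-x∣ p x = ≤-trans (p⊆q⇒∣p∣≤∣q∣ (p-x⊆q⇒p⊆⁅x⁆∪q {q = p - x} id)) (∣⁅x⁆∪p∣≤1+∣p∣ x (p - x))

x∉p⇒∣p∣<∣⁅x⁆∪p∣ : x ∉ p → ∣ p ∣ < ∣ ⁅ x ⁆ ∪ p ∣
x∉p⇒∣p∣<∣⁅x⁆∪p∣ x∉p = p⊂q⇒∣p∣<∣q∣ (x∈p⇒x∈⁅y⁆∪p , _ , y∈⁅y⁆∪p , x∉p)

Empty⇒∣p∣≡0 : ∀ (p : Subset n) → Empty p → ∣ p ∣ ≡ 0
Empty⇒∣p∣≡0 {n} p p-empty = trans (cong ∣_∣ (Empty-unique p-empty)) (∣⊥∣≡0 n)

subsingleton⇒∣p∣≤1 : ∀ (p : Subset n) → (∀ {x y} → x ∈ p → y ∈ p → x ≡ y) → ∣ p ∣ ≤ 1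
subsingleton⇒∣p∣≤1 p subsingleton with nonempty? p
... | no p-empty    = ≤-trans (≤-reflexive (Empty⇒∣p∣≡0 p p-empty)) z≤n
... | yes (x , x∈p) = ≤-trans (∣p∣≤1+∣p-x∣ p x) (s≤s (≤-reflexive (Empty⇒∣p∣≡0 (p - x) p-x-empty)))
  where
  p-x-empty : Empty (p - x)
  p-x-empty (y , y∈p-x) = x∈p-y⇒x≢y y∈p-x (subsingleton (x∈p-y⇒x∈p y∈p-x) x∈p)

n≤⌈n/2⌉+⌈n/2⌉ : ∀ n → n ≤ ⌈ n /2⌉ + ⌈ n /2⌉
n≤⌈n/2⌉+⌈n/2⌉ n = subst (_≤ ⌈ n /2⌉ + ⌈ n /2⌉) (⌊n/2⌋+⌈n/2⌉≡n n) (+-monoˡ-≤ ⌈ n /2⌉ (⌊n/2⌋≤⌈n/2⌉ n))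

module _ {n : ℕ} where

  private variable
    d d′ : ℕ
    v : Fin n
    σ τ : Subset n
    X Y K L D : Complex n

  free-resp-≐ : X ≐ Y → FreeIn X σ τ → FreeIn Y σ τ
  free-resp-≐ (X⊆Y , Y⊆X) (Xσ , Xτ , σ⊆τ , maximal) =
    X⊆Y Xσ , X⊆Y Xτ , σ⊆τ , λ η Yη → maximal η (Y⊆X Yη)

  remove-resp-≐ : X ≐ Y → remove X σ τ ≐ remove Y σ τ
  remove-resp-≐ (X⊆Y , Y⊆X) = (λ (Xη , kept) → X⊆Y Xη , kept) , (λ (Yη , kept) → Y⊆X Yη , kept)

  collapsible-resp-≐ : X ≐ Y → Collapsible d X → Collapsible d Y
  collapsible-resp-≐ (_ , Y⊆X) (void empty) = void λ η Yη → empty η (Y⊆X Yη)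
  collapsible-resp-≐ X≐Y (step σ τ free |σ|≤d rest) =
    step σ τ (free-resp-≐ X≐Y free) |σ|≤d (collapsible-resp-≐ (remove-resp-≐ X≐Y) rest)

  simplex-collapsible : X ⊥ → X τ → (∀ {η} → X η → η ⊆ τ) → Collapsible d X
  simplex-collapsible {X = X} {τ = τ} {d = d} X⊥ Xτ faces⊆τ =
    step ⊥ τ (X⊥ , Xτ , ⊥⊆ , λ η Xη _ → faces⊆τ Xη) |⊥|≤d
      (void λ η (Xη , kept) → kept (⊥⊆ , faces⊆τ Xη))
    where
    |⊥|≤d : ∣ ⊥ {n} ∣ ≤ d
    |⊥|≤d = subst (_≤ d) (sym (∣⊥∣≡0 n)) z≤n

  Avoids : Fin n → Complex n → Set
  Avoids v X = ∀ {η} → X η → v ∉ η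

  -- The cone v ∗ K, when K does not have v as a vertex.
  Cone : Fin n → Complex n → Complex n
  Cone v K η = K (η - v)

  -- D ∪ v ∗ L, when neither complex has v as a vertex.
  Attach : Fin n → Complex n → Complex n → Complex n
  Attach v L D η = (v ∉ η × D η) ⊎ (v ∈ η × L (η - v))

  cone-free : Avoids v K → FreeIn K σ τ → FreeIn (Cone v K) σ (⁅ v ⁆ ∪ τ)
  cone-free {v = v} {K = K} {σ = σ} {τ = τ} v∉K (Kσ , Kτ , σ⊆τ , maximal) =
    subst K (sym (p-x≡p v∉σ)) Kσ ,
    subst K (sym (⁅x⁆∪p-x≡p v∉τ)) Kτ ,
    (λ x∈σ → x∈p⇒x∈⁅y⁆∪p (σ⊆τ x∈σ)) ,
    λ η Kη-v σ⊆η → p-x⊆q⇒p⊆⁅x⁆∪q (maximal (η - v) Kη-v (x∉p∧p⊆q⇒p⊆q-x v∉σ σ⊆η))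
    where
    v∉σ = v∉K Kσ
    v∉τ = v∉K Kτ

  cone-remove : Avoids v K → K σ → Cone v (remove K σ τ) ≐ remove (Cone v K) σ (⁅ v ⁆ ∪ τ)
  cone-remove {v = v} {σ = σ} {τ = τ} v∉K Kσ =
    (λ (Kη-v , kept) → Kη-v , λ between → kept (from (between-⇔ _) between)) ,
    (λ (Kη-v , kept) → Kη-v , λ between → kept (to (between-⇔ _) between))
    where
    open Equivalence
    between-⇔ : ∀ η → (σ ⊆ η - v × η - v ⊆ τ) ⇔ (σ ⊆ η × η ⊆ ⁅ v ⁆ ∪ τ)
    between-⇔ η = p⊆q-x⇔p⊆q (v∉K Kσ) ×-⇔ p-x⊆q⇔p⊆⁅x⁆∪q

  cone-collapsible : Avoids v K → Collapsible d K → Collapsible d (Cone v K)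
  cone-collapsible {v = v} v∉K (void empty) = void λ η → empty (η - v)
  cone-collapsible {v = v} v∉K (step σ τ free@(Kσ , _) |σ|≤d rest) =
    step σ (⁅ v ⁆ ∪ τ) (cone-free v∉K free) |σ|≤d
      (collapsible-resp-≐ (cone-remove v∉K Kσ) (cone-collapsible (λ (Kη , _) → v∉K Kη) rest))

  attach-free : Avoids v L → FreeIn L σ τ → FreeIn (Attach v L D) (⁅ v ⁆ ∪ σ) (⁅ v ⁆ ∪ τ)
  attach-free {v = v} {L = L} {σ = σ} {τ = τ} {D = D} v∉L (Lσ , Lτ , σ⊆τ , maximal) =
    inj₂ (y∈⁅y⁆∪p , subst L (sym (⁅x⁆∪p-x≡p v∉σ)) Lσ) ,
    inj₂ (y∈⁅y⁆∪p , subst L (sym (⁅x⁆∪p-x≡p v∉τ)) Lτ) ,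
    ⁅v⁆∪σ⊆⁅v⁆∪τ ,
    maximal′
    where
    v∉σ = v∉L Lσ
    v∉τ = v∉L Lτ
    ⁅v⁆∪σ⊆⁅v⁆∪τ : ⁅ v ⁆ ∪ σ ⊆ ⁅ v ⁆ ∪ τ
    ⁅v⁆∪σ⊆⁅v⁆∪τ x∈ with x∈⁅y⁆∪p⁻ x∈
    ... | inj₁ refl = y∈⁅y⁆∪p
    ... | inj₂ x∈σ  = x∈p⇒x∈⁅y⁆∪p (σ⊆τ x∈σ)
    maximal′ : ∀ η → Attach v L D η → ⁅ v ⁆ ∪ σ ⊆ η → η ⊆ ⁅ v ⁆ ∪ τ
    maximal′ η (inj₁ (v∉η , _))     ⁅v⁆∪σ⊆η = contradiction (⁅v⁆∪σ⊆η y∈⁅y⁆∪p) v∉η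
    maximal′ η (inj₂ (v∈η , Lη-v)) ⁅v⁆∪σ⊆η =
      p-x⊆q⇒p⊆⁅x⁆∪q (maximal (η - v) Lη-v (Equivalence.from (p⊆q-x⇔⁅x⁆∪p⊆q v∈η v∉σ) ⁅v⁆∪σ⊆η))

  attach-remove : Avoids v L → L σ →
                  Attach v (remove L σ τ) D ≐ remove (Attach v L D) (⁅ v ⁆ ∪ σ) (⁅ v ⁆ ∪ τ)
  attach-remove {v = v} {L = L} {σ = σ} {τ = τ} {D = D} v∉L Lσ = to-remove , from-remove
    where
    open Equivalence
    between-⇔ : ∀ {η} → v ∈ η → (σ ⊆ η - v × η - v ⊆ τ) ⇔ (⁅ v ⁆ ∪ σ ⊆ η × η ⊆ ⁅ v ⁆ ∪ τ)
    between-⇔ v∈η = p⊆q-x⇔⁅x⁆∪p⊆q v∈η (v∉L Lσ) ×-⇔ p-x⊆q⇔p⊆⁅x⁆∪q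
    to-remove : ∀ {η} → Attach v (remove L σ τ) D η →
                remove (Attach v L D) (⁅ v ⁆ ∪ σ) (⁅ v ⁆ ∪ τ) η
    to-remove (inj₁ (v∉η , Dη)) =
      inj₁ (v∉η , Dη) , λ (⁅v⁆∪σ⊆η , _) → v∉η (⁅v⁆∪σ⊆η y∈⁅y⁆∪p)
    to-remove (inj₂ (v∈η , Lη-v , kept)) =
      inj₂ (v∈η , Lη-v) , λ between → kept (from (between-⇔ v∈η) between)
    from-remove : ∀ {η} → remove (Attach v L D) (⁅ v ⁆ ∪ σ) (⁅ v ⁆ ∪ τ) η →
                  Attach v (remove L σ τ) D η
    from-remove (inj₁ D-part , _) = inj₁ D-part
    from-remove (inj₂ (v∈η , Lη-v) , kept) =
      inj₂ (v∈η , Lη-v , λ between → kept (to (between-⇔ v∈η) between))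

  attach-void : Avoids v D → (∀ η → ¬ L η) → D ≐ Attach v L D
  attach-void {v = v} {D = D} {L = L} v∉D empty =
    (λ Dη → inj₁ (v∉D Dη , Dη)) , D-part
    where
    D-part : ∀ {η} → Attach v L D η → D η
    D-part (inj₁ (_ , Dη))   = Dη
    D-part (inj₂ (_ , Lη-v)) = ⊥-elim (empty _ Lη-v)

  attach-collapsible : Avoids v L → Avoids v D → suc d′ ≤ d →
                       Collapsible d′ L → Collapsible d D → Collapsible d (Attach v L D)
  attach-collapsible v∉L v∉D d′<d (void empty) D↓ = collapsible-resp-≐ (attach-void v∉D empty) D↓
  attach-collapsible {v = v} v∉L v∉D d′<d (step σ τ free@(Lσ , _) |σ|≤d′ rest) D↓ =
    step (⁅ v ⁆ ∪ σ) (⁅ v ⁆ ∪ τ) (attach-free v∉L free)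
      (≤-trans (∣⁅x⁆∪p∣≤1+∣p∣ v σ) (≤-trans (s≤s |σ|≤d′) d′<d))
      (collapsible-resp-≐ (attach-remove v∉L Lσ)
        (attach-collapsible (λ (Lη , _) → v∉L Lη) v∉D d′<d rest D↓))

module _ {n : ℕ} (G : Graph n) where

  private variable
    d : ℕ
    v : Fin n
    η S U : Subset n

  ∈neighbours⇒adj : x ∈ neighbours G v → adj G v x ≡ true
  ∈neighbours⇒adj {x = x} {v = v} x∈N = trans (sym (lookup∘tabulate (adj G v) x)) ([]=⇒lookup x∈N)

  adj⇒∈neighbours : adj G v x ≡ true → x ∈ neighbours G v
  adj⇒∈neighbours {v = v} {x = x} adj≡true =
    lookup⇒[]= x (neighbours G v) (trans (lookup∘tabulate (adj G v) x) adj≡true)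

  v∉neighbours[v] : v ∉ neighbours G v
  v∉neighbours[v] {v = v} v∈N = contradiction (trans (sym (∈neighbours⇒adj v∈N)) (irrefl G v)) λ ()

  Clique : Subset n → Set
  Clique η = ∀ {x y} → x ∈ η → y ∈ η → x ≢ y → adj G x y ≡ true

  clique-⊆ : η ⊆ S → Clique S → Clique η
  clique-⊆ η⊆S clique x∈η y∈η = clique (η⊆S x∈η) (η⊆S y∈η)

  Adjacent-to-all : Fin n → Subset n → Set
  Adjacent-to-all v η = ∀ {x} → x ∈ η → x ≢ v → adj G v x ≡ true

  clique-from-apex : Adjacent-to-all v η → Clique (η - v) → Clique η
  clique-from-apex {v = v} apex clique {x} {y} x∈η y∈η x≢y with x ≟ᶠ v | y ≟ᶠ v
  ... | yes refl | yes refl = contradiction refl x≢y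
  ... | yes refl | no y≢v   = apex y∈η y≢v
  ... | no x≢v   | yes refl = trans (Graph.sym G x v) (apex x∈η x≢v)
  ... | no x≢v   | no y≢v   = clique (x∈p∧x≢y⇒x∈p-y x∈η x≢v) (x∈p∧x≢y⇒x∈p-y y∈η y≢v) x≢y

  CliqueComplex : Subset n → Complex n
  CliqueComplex S η = η ⊆ S × Clique η

  cliqueComplex-avoids : v ∉ S → Avoids v (CliqueComplex S)
  cliqueComplex-avoids v∉S (η⊆S , _) v∈η = v∉S (η⊆S v∈η)

  cone≐cliqueComplex : v ∈ S → Adjacent-to-all v S →
                       Cone v (CliqueComplex (S - v)) ≐ CliqueComplex S
  cone≐cliqueComplex {v = v} {S = S} v∈S v-dominates = from-cone , to-cone
    where
    from-cone : ∀ {η} → Cone v (CliqueComplex (S - v)) η → CliqueComplex S η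
    from-cone (η-v⊆S-v , clique) = η⊆S , clique-from-apex (λ x∈η → v-dominates (η⊆S x∈η)) clique
      where
      η⊆S = x∈q∧p-x⊆q⇒p⊆q v∈S (λ x∈η-v → x∈p-y⇒x∈p (η-v⊆S-v x∈η-v))
    to-cone : ∀ {η} → CliqueComplex S η → Cone v (CliqueComplex (S - v)) η
    to-cone (η⊆S , clique) = p⊆q⇒p-x⊆q-x η⊆S , clique-⊆ x∈p-y⇒x∈p clique

  attach≐cliqueComplex : v ∈ S →
    Attach v (CliqueComplex (neighbours G v ∩ S)) (CliqueComplex (S - v)) ≐ CliqueComplex S
  attach≐cliqueComplex {v = v} {S = S} v∈S = from-attach , to-attach
    where
    from-attach : ∀ {η} → Attach v (CliqueComplex (neighbours G v ∩ S)) (CliqueComplex (S - v)) η →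
                  CliqueComplex S η
    from-attach (inj₁ (_ , η⊆S-v , clique)) = (λ x∈η → x∈p-y⇒x∈p (η⊆S-v x∈η)) , clique
    from-attach (inj₂ (_ , η-v⊆N∩S , clique)) =
      x∈q∧p-x⊆q⇒p⊆q v∈S (λ x∈η-v → proj₂ (x∈p∩q⁻ _ S (η-v⊆N∩S x∈η-v))) ,
      clique-from-apex
        (λ x∈η x≢v → ∈neighbours⇒adj (proj₁ (x∈p∩q⁻ _ S (η-v⊆N∩S (x∈p∧x≢y⇒x∈p-y x∈η x≢v)))))
        clique
    to-attach : ∀ {η} → CliqueComplex S η →
                Attach v (CliqueComplex (neighbours G v ∩ S)) (CliqueComplex (S - v)) η
    to-attach {η} (η⊆S , clique) with v ∈? η
    ... | no v∉η  = inj₁ (v∉η , x∉p∧p⊆q⇒p⊆q-x v∉η η⊆S , clique)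
    ... | yes v∈η = inj₂ (v∈η , η-v⊆N∩S , clique-⊆ x∈p-y⇒x∈p clique)
      where
      η-v⊆N∩S : η - v ⊆ neighbours G v ∩ S
      η-v⊆N∩S x∈η-v =
        x∈p∩q⁺ (adj⇒∈neighbours (clique v∈η (x∈p-y⇒x∈p x∈η-v) (≢-sym (x∈p-y⇒x≢y x∈η-v))) ,
                η⊆S (x∈p-y⇒x∈p x∈η-v))

  -- d cannot be inferred from DegreeBound d S, which only mentions d + d.
  DegreeBound : ℕ → Subset n → Set
  DegreeBound d S = ∀ v → v ∈ S → Adjacent-to-all v S ⊎ suc ∣ neighbours G v ∩ S ∣ ≤ d + d

  degreeBound-delete : DegreeBound d S → DegreeBound d (S - v)
  degreeBound-delete {S = S} {v = v} bound w w∈S-v with bound w (x∈p-y⇒x∈p w∈S-v)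
  ... | inj₁ w-dominates = inj₁ λ x∈S-v → w-dominates (x∈p-y⇒x∈p x∈S-v)
  ... | inj₂ deg<2d      = inj₂ (≤-trans (s≤s (p⊆q⇒∣p∣≤∣q∣ N∩[S-v]⊆N∩S)) deg<2d)
    where
    N∩[S-v]⊆N∩S : neighbours G w ∩ (S - v) ⊆ neighbours G w ∩ S
    N∩[S-v]⊆N∩S x∈ = let x∈N , x∈S-v = x∈p∩q⁻ _ (S - v) x∈ in x∈p∩q⁺ (x∈N , x∈p-y⇒x∈p x∈S-v)

  degreeBound-small : ∣ S ∣ ≤ suc (d + d) → DegreeBound d S
  degreeBound-small {S = S} |S|≤2d+1 w w∈S
    with any? (λ x → x ∈? S ×-dec ¬? (x ≟ᶠ w) ×-dec adj G w x Bool.≟ false)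
  ... | no no-non-neighbour =
    inj₁ λ x∈S x≢w → Bool.¬-not λ adj≡false → no-non-neighbour (_ , x∈S , x≢w , adj≡false)
  ... | yes (x , x∈S , x≢w , adj≡false) = inj₂ (≤-pred (≤-trans 2+deg≤|S| |S|≤2d+1))
    where
    N∩S⊆S-w-x : neighbours G w ∩ S ⊆ S - w - x
    N∩S⊆S-w-x y∈ with x∈p∩q⁻ _ S y∈
    ... | y∈N , y∈S =
      x∈p∧x≢y⇒x∈p-y (x∈p∧x≢y⇒x∈p-y y∈S λ { refl → v∉neighbours[v] y∈N })
                    λ { refl → contradiction (trans (sym (∈neighbours⇒adj y∈N)) adj≡false) λ () }
    open ≤-Reasoning
    2+deg≤|S| : suc (suc ∣ neighbours G w ∩ S ∣) ≤ ∣ S ∣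
    2+deg≤|S| = begin
      suc (suc ∣ neighbours G w ∩ S ∣) ≤⟨ s≤s (s≤s (p⊆q⇒∣p∣≤∣q∣ N∩S⊆S-w-x)) ⟩
      suc (suc ∣ S - w - x ∣)          ≤⟨ s≤s (x∈p⇒∣p-x∣<∣p∣ (x∈p∧x≢y⇒x∈p-y x∈S x≢w)) ⟩
      suc ∣ S - w ∣                    ≤⟨ x∈p⇒∣p-x∣<∣p∣ w∈S ⟩
      ∣ S ∣                            ∎

  cliqueComplex-empty-collapsible : (∀ {v} → v ∉ S) → Collapsible d (CliqueComplex S)
  cliqueComplex-empty-collapsible S-empty =
    simplex-collapsible (⊥⊆ , clique-⊥) (⊥⊆ , clique-⊥)
      λ (η⊆S , _) x∈η → contradiction (η⊆S x∈η) S-empty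
    where
    clique-⊥ : Clique ⊥
    clique-⊥ x∈⊥ = contradiction x∈⊥ ∉⊥

  cone-step : v ∈ S → Adjacent-to-all v S →
              Collapsible d (CliqueComplex (S - v)) → Collapsible d (CliqueComplex S)
  cone-step v∈S v-dominates deletion↓ =
    collapsible-resp-≐ (cone≐cliqueComplex v∈S v-dominates)
      (cone-collapsible (cliqueComplex-avoids x∉p-x) deletion↓)

  Collapsible-below : Subset n → Set₁
  Collapsible-below S =
    ∀ d {S′} → ∣ S′ ∣ < ∣ S ∣ → DegreeBound d S′ → Collapsible d (CliqueComplex S′)

  attach-step : v ∈ S → suc ∣ neighbours G v ∩ S ∣ ≤ d + d → DegreeBound d S →
                Collapsible-below S → Collapsible d (CliqueComplex S)
  attach-step {v} {S} {suc d′} v∈S deg<2d bound ih =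
    collapsible-resp-≐ (attach≐cliqueComplex v∈S)
      (attach-collapsible (cliqueComplex-avoids v∉N∩S) (cliqueComplex-avoids x∉p-x) ≤-refl
        (ih d′ |N∩S|<|S| (degreeBound-small {d = d′} |N∩S|≤2d′+1))
        (ih (suc d′) (x∈p⇒∣p-x∣<∣p∣ v∈S) (degreeBound-delete {d = suc d′} {v = v} bound)))
    where
    v∉N∩S : v ∉ neighbours G v ∩ S
    v∉N∩S v∈N∩S = v∉neighbours[v] (proj₁ (x∈p∩q⁻ _ S v∈N∩S))
    N∩S⊆S-v : neighbours G v ∩ S ⊆ S - v
    N∩S⊆S-v x∈N∩S = x∉p∧p⊆q⇒p⊆q-x v∉N∩S (p∩q⊆q _ S) x∈N∩S
    |N∩S|<|S| : ∣ neighbours G v ∩ S ∣ < ∣ S ∣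
    |N∩S|<|S| = ≤-trans (s≤s (p⊆q⇒∣p∣≤∣q∣ N∩S⊆S-v)) (x∈p⇒∣p-x∣<∣p∣ v∈S)
    |N∩S|≤2d′+1 : ∣ neighbours G v ∩ S ∣ ≤ suc (d′ + d′)
    |N∩S|≤2d′+1 = subst (∣ neighbours G v ∩ S ∣ ≤_) (+-suc d′ d′) (≤-pred deg<2d)

  delete-vertex-collapsible : v ∈ S → DegreeBound d S → Collapsible-below S →
                              Collapsible d (CliqueComplex S)
  delete-vertex-collapsible {v} {S} {d} v∈S bound ih with bound v v∈S
  ... | inj₁ v-dominates =
    cone-step v∈S v-dominates (ih d (x∈p⇒∣p-x∣<∣p∣ v∈S) (degreeBound-delete {d = d} {v = v} bound))
  ... | inj₂ deg<2d      = attach-step v∈S deg<2d bound ih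

  cliqueComplex-collapsible : ∀ k → ∣ S ∣ ≤ k → DegreeBound d S → Collapsible d (CliqueComplex S)
  cliqueComplex-collapsible {S = S} k |S|≤k bound with nonempty? S
  ... | no S-empty = cliqueComplex-empty-collapsible λ v∈S → S-empty (_ , v∈S)
  cliqueComplex-collapsible zero    |S|≤0   bound | yes (v , v∈S) =
    contradiction (≤-trans (x∈p⇒∣p-x∣<∣p∣ v∈S) |S|≤0) λ ()
  cliqueComplex-collapsible (suc k) |S|≤1+k bound | yes (v , v∈S) =
    delete-vertex-collapsible v∈S bound λ d′ |S′|<|S| →
      cliqueComplex-collapsible k (≤-pred (≤-trans |S′|<|S| |S|≤1+k))

  maxDegree⇒degreeBound : ∀ {Δ} → MaxDegreeAtMost G Δ → DegreeBound ⌈ suc Δ /2⌉ ⊤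
  maxDegree⇒degreeBound {Δ} maxDegree v _ =
    inj₂ (≤-trans (s≤s (≤-trans (∣p∩q∣≤∣p∣ (neighbours G v) ⊤) (maxDegree v)))
                  (n≤⌈n/2⌉+⌈n/2⌉ (suc Δ)))

  clique⇒independent-subsingleton : Clique U → Independent G U → x ∈ U → y ∈ U → x ≡ y
  clique⇒independent-subsingleton {x = x} {y = y} clique independent x∈U y∈U with x ≟ᶠ y
  ... | yes x≡y = x≡y
  ... | no x≢y  = contradiction (trans (sym (clique x∈U y∈U x≢y)) (independent x y x∈U y∈U)) λ ()

  independent-pair : adj G x y ≡ false → Independent G (⁅ x ⁆ ∪ ⁅ y ⁆)
  independent-pair {x = x} {y = y} adj≡false u w u∈ w∈ with x∈⁅y⁆∪p⁻ u∈ | x∈⁅y⁆∪p⁻ w∈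
  ... | inj₁ refl | inj₁ refl = irrefl G x
  ... | inj₁ refl | inj₂ w∈⁅y⁆ rewrite x∈⁅y⁆⇒x≡y y w∈⁅y⁆ = adj≡false
  ... | inj₂ u∈⁅y⁆ | inj₁ refl rewrite x∈⁅y⁆⇒x≡y y u∈⁅y⁆ = trans (Graph.sym G y x) adj≡false
  ... | inj₂ u∈⁅y⁆ | inj₂ w∈⁅y⁆ rewrite x∈⁅y⁆⇒x≡y y u∈⁅y⁆ | x∈⁅y⁆⇒x≡y y w∈⁅y⁆ = irrefl G y

  cliqueComplex⊤≐I₂ : CliqueComplex ⊤ ≐ I 2 G
  cliqueComplex⊤≐I₂ = to-I₂ , from-I₂
    where
    to-I₂ : ∀ {U} → CliqueComplex ⊤ U → I 2 G U
    to-I₂ (_ , clique) W W⊆U independent =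
      s≤s (subsingleton⇒∣p∣≤1 W (clique⇒independent-subsingleton (clique-⊆ W⊆U clique) independent))
    from-I₂ : ∀ {U} → I 2 G U → CliqueComplex ⊤ U
    from-I₂ {U} α<2 = (λ _ → ∈⊤) , clique
      where
      clique : Clique U
      clique {x} {y} x∈U y∈U x≢y with adj G x y in adj≡
      ... | true  = refl
      ... | false = ⊥-elim (≤⇒≯ 2≤∣pair∣ (α<2 (⁅ x ⁆ ∪ ⁅ y ⁆) pair⊆U (independent-pair adj≡)))
        where
        pair⊆U : ⁅ x ⁆ ∪ ⁅ y ⁆ ⊆ U
        pair⊆U z∈ with x∈⁅y⁆∪p⁻ z∈
        ... | inj₁ refl = x∈U
        ... | inj₂ z∈⁅y⁆ rewrite x∈⁅y⁆⇒x≡y y z∈⁅y⁆ = y∈U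
        2≤∣pair∣ : 2 ≤ ∣ ⁅ x ⁆ ∪ ⁅ y ⁆ ∣
        2≤∣pair∣ = subst (λ k → suc k ≤ ∣ ⁅ x ⁆ ∪ ⁅ y ⁆ ∣) (∣⁅x⁆∣≡1 y)
                         (x∉p⇒∣p∣<∣⁅x⁆∪p∣ (x≢y⇒x∉⁅y⁆ x≢y))

theorem1p7 : ∀ {n : ℕ} (G : Graph n) (Δ : ℕ) → MaxDegreeAtMost G Δ →
    CollapsibilityAtMost (I 2 G) ⌈ suc Δ /2⌉
theorem1p7 {n} G Δ maxDegree =
  collapsible-resp-≐ (cliqueComplex⊤≐I₂ G)
    (cliqueComplex-collapsible G n (∣p∣≤n ⊤) (maxDegree⇒degreeBound G maxDegree))
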